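{- Let $k$ be a separated complete linearly topologized ring and let $M,N$ be uniform linearly topologized $k$-modules with $M$ barrelled and $N$ separated and complete. Then both $\mathcal L_k^s(M,N)$ and $\mathcal L_k^b(M,N)$ are separated and complete.
   Context: Rings are commutative with $1$. A linearly topologized ring $k$ has a group topology with a basis of neighbourhoods of $0$ of ideals; $\mathcal P(k)$ is the set of open ideals. A linearly topologized $k$-module has a group topology with a basis of neighbourhoods of $0$ of $k$-submodules with each $m\mapsto am$ continuous; uniform means for each open submodule $P$ some $I\in\mathcal P(k)$ has $IM\subseteq P$. A subset $P\subseteq M$ is a sponge if for each $m\in M$ some $I\in\mathcal P(k)$ has $Im\subseteq P$; $M$ is barrelled if every closed $k$-submodule of $M$ that is a sponge is open. $\mathcal L_k^b(M,N)$ (resp. $\mathcal L_k^s(M,N)$) is the $k$-module of continuous $k$-linear maps $M\to N$ with basis of open submodules $\{f: f(B)\subseteq Q\}$, $Q$ an open submodule of $N$ and $B=M$ (resp. $B$ a finite subset of $M$). -}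

module Defs where

open import Level using (Level; _⊔_; suc; Setω)
open import Algebra.Bundles using (CommutativeRing)
open import Algebra.Module.Bundles using (Module)
open import Data.Product using (Σ; ∃; _×_; _,_)
open import Data.List using (List)
open import Data.List.Relation.Unary.All using (All)
open import Relation.Unary using (Pred)

private variable
  c ℓ i p m ℓm j q d e a : Level

-- Generic uniform notions, given by a family of "entourages"
-- Near a x y  (for a linearly topologized group: x - y ∈ U a).

record DirectedSet (d e : Level) : Set (suc (d ⊔ e)) where
  field
    D        : Set d
    _≤_      : D → D → Set e
    ≤-refl   : ∀ x → x ≤ x
    ≤-trans  : ∀ {x y z} → x ≤ y → y ≤ z → x ≤ z
    inhabited : D
    upper    : ∀ x y → Σ D (λ z → (x ≤ z) × (y ≤ z))

module _ {A : Set a} {ι : Set i} (Near : ι → A → A → Set q) where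

  Separated : (_≈_ : A → A → Set ℓ) → Set (a ⊔ i ⊔ q ⊔ ℓ)
  Separated _≈_ = ∀ x y → (∀ u → Near u x y) → x ≈ y

  module _ (Dir : DirectedSet d e) where
    open DirectedSet Dir

    IsCauchy : (D → A) → Set (i ⊔ q ⊔ d ⊔ e)
    IsCauchy x = ∀ u → Σ D (λ δ → ∀ s t → δ ≤ s → δ ≤ t → Near u (x s) (x t))

    ConvergesTo : (D → A) → A → Set (i ⊔ q ⊔ d ⊔ e)
    ConvergesTo x y = ∀ u → Σ D (λ δ → ∀ s → δ ≤ s → Near u (x s) y)

  CompleteAt : (d e : Level) → Set (a ⊔ i ⊔ q ⊔ suc (d ⊔ e))
  CompleteAt d e = (Dir : DirectedSet d e) (x : DirectedSet.D Dir → A) →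
                   IsCauchy Dir x → Σ A (ConvergesTo Dir x)

  Complete : Setω
  Complete = ∀ {d e} → CompleteAt d e

module _ (R : CommutativeRing c ℓ) where
  open CommutativeRing R

  record IsIdeal (I : Pred Carrier p) : Set (c ⊔ ℓ ⊔ p) where
    field
      resp  : ∀ {x y} → x ≈ y → I x → I y
      zero∈ : I 0#
      +∈    : ∀ {x y} → I x → I y → I (x + y)
      *∈    : ∀ r {x} → I x → I (r * x)

  -- a linear topology given by a basis (J u)_{u : Idx} of neighbourhoods of 0
  -- consisting of ideals
  record LinTopRing (i p : Level) : Set (c ⊔ ℓ ⊔ suc (i ⊔ p)) where
    field
      Idx       : Set i
      J         : Idx → Pred Carrier p
      J-ideal   : ∀ u → IsIdeal (J u)
      inhabited : Idx
      directed  : ∀ u v → Σ Idx (λ w → ∀ x → J w x → J u x × J v x)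

    NearR : Idx → Carrier → Carrier → Set p
    NearR u x y = J u (x - y)

module _ {R : CommutativeRing c ℓ} where
  open CommutativeRing R

  module _ (Mod : Module R m ℓm) where
    open Module Mod

    record IsSubmodule (P : Pred Carrierᴹ q) : Set (c ⊔ m ⊔ ℓm ⊔ q) where
      field
        resp  : ∀ {x y} → x ≈ᴹ y → P x → P y
        zero∈ : P 0ᴹ
        +∈    : ∀ {x y} → P x → P y → P (x +ᴹ y)
        *∈    : ∀ r {x} → P x → P (r *ₗ x)

  record LinTopModule (k : LinTopRing R i p) (m ℓm j q : Level)
         : Set (c ⊔ ℓ ⊔ suc (m ⊔ ℓm ⊔ j ⊔ q)) where
    field
      mod       : Module R m ℓm
    open Module mod
    field
      Idx       : Set j
      U         : Idx → Pred Carrierᴹ q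
      U-sub     : ∀ u → IsSubmodule mod (U u)
      inhabited : Idx
      directed  : ∀ u v → Σ Idx (λ w → ∀ x → U w x → U u x × U v x)
      scal-cont : ∀ r u → Σ Idx (λ v → ∀ x → U v x → U u (r *ₗ x))

    _-ᴹ_ : Carrierᴹ → Carrierᴹ → Carrierᴹ
    x -ᴹ y = x +ᴹ (-ᴹ y)

    NearM : Idx → Carrierᴹ → Carrierᴹ → Set q
    NearM u x y = U u (x -ᴹ y)

  module _ {k : LinTopRing R i p} where
    open LinTopRing k using (J) renaming (Idx to Idxk)

    module _ (M : LinTopModule k m ℓm j q) where
      open LinTopModule M
      open Module mod

      Uniform : Set (c ⊔ i ⊔ p ⊔ m ⊔ j ⊔ q)
      Uniform = ∀ u → Σ Idxk (λ t → ∀ r x → J t r → U u (r *ₗ x))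

      InClosure : Pred Carrierᴹ a → Pred Carrierᴹ (j ⊔ m ⊔ a ⊔ q)
      InClosure S x = ∀ u → Σ Carrierᴹ (λ y → S y × U u (x -ᴹ y))

      Closed : Pred Carrierᴹ a → Set (j ⊔ m ⊔ a ⊔ q)
      Closed S = ∀ x → InClosure S x → S x

      -- a submodule is open iff it contains a neighbourhood of 0
      OpenSub : Pred Carrierᴹ a → Set (j ⊔ m ⊔ a ⊔ q)
      OpenSub S = Σ Idx (λ u → ∀ x → U u x → S x)

      Sponge : Pred Carrierᴹ a → Set (i ⊔ m ⊔ c ⊔ p ⊔ a)
      Sponge S = ∀ x → Σ Idxk (λ t → ∀ r → J t r → S (r *ₗ x))

      BarrelledAt : (a : Level) → Set (c ⊔ i ⊔ p ⊔ m ⊔ ℓm ⊔ j ⊔ q ⊔ suc a)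
      BarrelledAt a = (S : Pred Carrierᴹ a) → IsSubmodule mod S →
                      Closed S → Sponge S → OpenSub S

      Barrelled : Setω
      Barrelled = ∀ {a} → BarrelledAt a

    module _ {m ℓm j q n ℓn j' q' : Level}
             (M : LinTopModule k m ℓm j q) (N : LinTopModule k n ℓn j' q') where
      private
        module M = LinTopModule M
        module N = LinTopModule N
        module MM = Module M.mod
        module NN = Module N.mod

      record ContLin : Set (c ⊔ m ⊔ ℓm ⊔ j ⊔ q ⊔ n ⊔ ℓn ⊔ j' ⊔ q') where
        field
          f      : MM.Carrierᴹ → NN.Carrierᴹ
          f-cong : ∀ {x y} → x MM.≈ᴹ y → f x NN.≈ᴹ f y
          f-+    : ∀ x y → f (x MM.+ᴹ y) NN.≈ᴹ (f x NN.+ᴹ f y)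
          f-*    : ∀ r x → f (r MM.*ₗ x) NN.≈ᴹ (r NN.*ₗ f x)
          f-cont : ∀ x v → Σ M.Idx (λ u → ∀ y →
                     M.U u (y M.-ᴹ x) → N.U v (f y N.-ᴹ f x))
      open ContLin

      _≈L_ : ContLin → ContLin → Set (m ⊔ ℓn)
      F ≈L G = ∀ x → f F x NN.≈ᴹ f G x

      -- L^s: basic neighbourhoods {h : h(B) ⊆ Q}, B finite, Q open submodule of N
      Near-s : (N.Idx × List MM.Carrierᴹ) → ContLin → ContLin → Set (m ⊔ q')
      Near-s (v , B) F G = All (λ x → N.U v (f F x N.-ᴹ f G x)) B

      -- L^b: basic neighbourhoods {h : h(M) ⊆ Q}
      Near-b : N.Idx → ContLin → ContLin → Set (m ⊔ q')
      Near-b v F G = ∀ x → N.U v (f F x N.-ᴹ f G x)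

module _ {R : CommutativeRing c ℓ} {k : LinTopRing R i p} where
  Module≈ : (N : LinTopModule k m ℓm j q) →
            Module.Carrierᴹ (LinTopModule.mod N) → Module.Carrierᴹ (LinTopModule.mod N) → Set ℓm
  Module≈ N = Module._≈ᴹ_ (LinTopModule.mod N)

record _×ω_ (A B : Setω) : Setω where
  constructor _,ω_
  field
    fst : A
    snd : B

record _×ˢω_ {a : Level} (A : Set a) (B : Setω) : Setω where
  constructor _,ˢω_
  field
    fst : A
    snd : B

-- The pointwise limit of a Cauchy net (f_s) of continuous linear maps exists
-- because N is complete, and is linear because N is separated.  It is
-- continuous because the family (f_s) is equicontinuous: for an open
-- submodule V of N, the set of x with f_s x ∈ V for all s is a closed
-- submodule, and a sponge because N is uniform, so it is open as M is
-- barrelled; V being closed, the limit maps it into V as well.  A Cauchy net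
-- for the topology of L^s resp. L^b then converges to this limit on finite
-- sets resp. uniformly.
{-# OPTIONS --safe #-}
module Submission where

open import Level using (Level; _⊔_)
open import Algebra.Bundles using (CommutativeRing; AbelianGroup)
open import Algebra.Module.Bundles using (Module)
import Algebra.Module.Properties as ModuleProperties
import Algebra.Properties.AbelianGroup as AbelianGroupProperties
import Algebra.Properties.CommutativeSemigroup as CommutativeSemigroupProperties
import Relation.Binary.Reasoning.Setoid as SetoidReasoning
open import Data.Product using (Σ; _×_; _,_; proj₁; proj₂; map₂; uncurry)
open import Data.List using (List; []; _∷_)
open import Data.List.Relation.Unary.All using (All; []; _∷_; head)
open import Relation.Unary using (Pred; ⋂; _⊢_)
open import Defs

private variable
  c ℓ i p m ℓm j q n ℓn j' q' d e a ι : Level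

module ModuleDifferences {R : CommutativeRing c ℓ} (mod : Module R m ℓm) where
  open CommutativeRing R using (1#; -_; _+_; 0#; -‿inverseʳ)
  open Module mod
  open ModuleProperties mod using (inverseʳ-uniqueᴹ)
  open AbelianGroupProperties +ᴹ-abelianGroup
    using (⁻¹-∙-comm; //-rightDividesˡ; //-rightDividesʳ; \\-leftDividesʳ)
  open CommutativeSemigroupProperties (AbelianGroup.commutativeSemigroup +ᴹ-abelianGroup)
    using (interchange)
  open SetoidReasoning ≈ᴹ-setoid

  infixl 6 _−_
  _−_ : Carrierᴹ → Carrierᴹ → Carrierᴹ
  x − y = x +ᴹ -ᴹ y

  -ᴹ≈-1*ₗ : ∀ x → -ᴹ x ≈ᴹ (- 1#) *ₗ x
  -ᴹ≈-1*ₗ x = ≈ᴹ-sym (inverseʳ-uniqueᴹ x ((- 1#) *ₗ x) (begin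
    x +ᴹ (- 1#) *ₗ x         ≈⟨ +ᴹ-congʳ (*ₗ-identityˡ x) ⟨
    1# *ₗ x +ᴹ (- 1#) *ₗ x   ≈⟨ *ₗ-distribʳ x 1# (- 1#) ⟨
    (1# + - 1#) *ₗ x         ≈⟨ *ₗ-congʳ (-‿inverseʳ 1#) ⟩
    0# *ₗ x                  ≈⟨ *ₗ-zeroˡ x ⟩
    0ᴹ                       ∎))

  −-trans : ∀ x y z → (x − y) +ᴹ (y − z) ≈ᴹ x − z
  −-trans x y z = begin
    (x − y) +ᴹ (y − z)       ≈⟨ +ᴹ-assoc x (-ᴹ y) (y − z) ⟩
    x +ᴹ (-ᴹ y +ᴹ (y − z))   ≈⟨ +ᴹ-congˡ (\\-leftDividesʳ y (-ᴹ z)) ⟩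
    x − z                    ∎

  −-+ : ∀ x x' y y' → (x − x') +ᴹ (y − y') ≈ᴹ (x +ᴹ y) − (x' +ᴹ y')
  −-+ x x' y y' = begin
    (x − x') +ᴹ (y − y')            ≈⟨ interchange x (-ᴹ x') y (-ᴹ y') ⟩
    (x +ᴹ y) +ᴹ (-ᴹ x' +ᴹ -ᴹ y')    ≈⟨ +ᴹ-congˡ (⁻¹-∙-comm x' y') ⟩
    (x +ᴹ y) − (x' +ᴹ y')           ∎

  *ₗ-distrib-− : ∀ r x y → r *ₗ (x − y) ≈ᴹ r *ₗ x − r *ₗ y
  *ₗ-distrib-− r x y = begin
    r *ₗ (x − y)                         ≈⟨ //-rightDividesʳ (r *ₗ y) (r *ₗ (x − y)) ⟨
    (r *ₗ (x − y) +ᴹ r *ₗ y) − r *ₗ y    ≈⟨ +ᴹ-congʳ (*ₗ-distribˡ r (x − y) y) ⟨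
    r *ₗ ((x − y) +ᴹ y) − r *ₗ y         ≈⟨ +ᴹ-congʳ (*ₗ-congˡ (//-rightDividesˡ y x)) ⟩
    r *ₗ x − r *ₗ y                      ∎

module SubmoduleCongruence
  {R : CommutativeRing c ℓ} {mod : Module R m ℓm}
  {S : Pred (Module.Carrierᴹ mod) q} (S-sub : IsSubmodule mod S) where
  open CommutativeRing R using (-_; 1#)
  open Module mod
  open IsSubmodule S-sub
  open ModuleDifferences mod
  open AbelianGroupProperties +ᴹ-abelianGroup
    using (x≈y⇒x∙y⁻¹≈ε; ⁻¹-anti-homo‿-; //-rightDividesˡ)

  infix 4 _∼_
  _∼_ : Carrierᴹ → Carrierᴹ → Set q
  x ∼ y = S (x − y)

  -ᴹ-∈ : ∀ {x} → S x → S (-ᴹ x)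
  -ᴹ-∈ {x} x∈S = resp (≈ᴹ-sym (-ᴹ≈-1*ₗ x)) (*∈ (- 1#) x∈S)

  ∼-reflexive : ∀ {x y} → x ≈ᴹ y → x ∼ y
  ∼-reflexive x≈y = resp (≈ᴹ-sym (x≈y⇒x∙y⁻¹≈ε x≈y)) zero∈

  ∼-sym : ∀ {x y} → x ∼ y → y ∼ x
  ∼-sym {x} {y} x∼y = resp (⁻¹-anti-homo‿- x y) (-ᴹ-∈ x∼y)

  ∼-trans : ∀ {x y z} → x ∼ y → y ∼ z → x ∼ z
  ∼-trans {x} {y} {z} x∼y y∼z = resp (−-trans x y z) (+∈ x∼y y∼z)

  +ᴹ-resp-∼ : ∀ {x x' y y'} → x ∼ x' → y ∼ y' → x +ᴹ y ∼ x' +ᴹ y'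
  +ᴹ-resp-∼ {x} {x'} {y} {y'} x∼x' y∼y' = resp (−-+ x x' y y') (+∈ x∼x' y∼y')

  ∈-resp-∼ : ∀ {x y} → x ∼ y → S y → S x
  ∈-resp-∼ {x} {y} x∼y y∈S = resp (//-rightDividesˡ y x) (+∈ x∼y y∈S)

⋂-submodule : ∀ {R : CommutativeRing c ℓ} {mod : Module R m ℓm}
  {I : Set ι} {S : I → Pred (Module.Carrierᴹ mod) a} →
  (∀ s → IsSubmodule mod (S s)) → IsSubmodule mod (⋂ I S)
⋂-submodule S-sub = record
  { resp  = λ x≈y x∈S s → IsSubmodule.resp (S-sub s) x≈y (x∈S s)
  ; zero∈ = λ s → IsSubmodule.zero∈ (S-sub s)
  ; +∈    = λ x∈S y∈S s → IsSubmodule.+∈ (S-sub s) (x∈S s) (y∈S s)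
  ; *∈    = λ r x∈S s → IsSubmodule.*∈ (S-sub s) r (x∈S s)
  }

module Eventually (Dir : DirectedSet d e) where
  open DirectedSet Dir

  Eventually : Pred D a → Set (a ⊔ d ⊔ e)
  Eventually P = Σ D λ δ → ∀ s → δ ≤ s → P s

  eventually-× : ∀ {b} {P : Pred D a} {Q : Pred D b} →
                 Eventually P → Eventually Q → Eventually (λ s → P s × Q s)
  eventually-× (δ₁ , P-from-δ₁) (δ₂ , Q-from-δ₂) with upper δ₁ δ₂
  ... | δ , δ₁≤δ , δ₂≤δ = δ , λ s δ≤s →
    P-from-δ₁ s (≤-trans δ₁≤δ δ≤s) , Q-from-δ₂ s (≤-trans δ₂≤δ δ≤s)

  eventually⇒∃ : ∀ {P : Pred D a} → Eventually P → Σ D P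
  eventually⇒∃ (δ , P-from-δ) = δ , P-from-δ δ (≤-refl δ)

  eventually-All : ∀ {b} {X : Set b} {P : X → Pred D a} (xs : List X) →
                   (∀ x → Eventually (P x)) → Eventually (λ s → All (λ x → P x s) xs)
  eventually-All []       _          = inhabited , λ _ _ → []
  eventually-All (x ∷ xs) eventually =
    map₂ (λ from-δ s δ≤s → uncurry _∷_ (from-δ s δ≤s))
         (eventually-× (eventually x) (eventually-All xs eventually))

module LinTopModuleProperties {R : CommutativeRing c ℓ} {k : LinTopRing R i p}
  (M : LinTopModule k m ℓm j q) where
  open CommutativeRing R using (Carrier)
  open LinTopModule M
  open Module mod
  open ModuleDifferences mod using (*ₗ-distrib-−)

  -- Near._∼_ v is NearM v by definition.
  module Near (v : Idx) = SubmoduleCongruence (U-sub v)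

  ⋂-closed : ∀ {I : Set ι} {S : I → Pred Carrierᴹ a} →
             (∀ s → Closed M (S s)) → Closed M (⋂ I S)
  ⋂-closed S-closed x x∈cl[⋂S] s = S-closed s x λ u →
    let y , y∈⋂S , x∼y = x∈cl[⋂S] u in y , y∈⋂S s , x∼y

  module Limits (Dir : DirectedSet d e) where
    open Eventually Dir
    open DirectedSet Dir using (D)

    U-closed-under-limits : ∀ {x : D → Carrierᴹ} {a v} →
      ConvergesTo NearM Dir x a → (∀ s → U v (x s)) → U v a
    U-closed-under-limits {v = v} x→a x∈U with eventually⇒∃ (x→a v)
    ... | s , xs∼a = Near.∈-resp-∼ v (Near.∼-sym v xs∼a) (x∈U s)

    +ᴹ-converges : ∀ {x y : D → Carrierᴹ} {a b} →
      ConvergesTo NearM Dir x a → ConvergesTo NearM Dir y b →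
      ConvergesTo NearM Dir (λ s → x s +ᴹ y s) (a +ᴹ b)
    +ᴹ-converges x→a y→b v =
      map₂ (λ from-δ s δ≤s → uncurry (Near.+ᴹ-resp-∼ v) (from-δ s δ≤s))
           (eventually-× (x→a v) (y→b v))

    *ₗ-converges : ∀ (r : Carrier) {x : D → Carrierᴹ} {a} →
      ConvergesTo NearM Dir x a → ConvergesTo NearM Dir (λ s → r *ₗ x s) (r *ₗ a)
    *ₗ-converges r {x} {a} x→a v with scal-cont r v
    ... | v' , r·U[v']⊆U[v] =
      map₂ (λ from-δ s δ≤s → IsSubmodule.resp (U-sub v) (*ₗ-distrib-− r (x s) a)
                                 (r·U[v']⊆U[v] _ (from-δ s δ≤s)))
           (x→a v')

    limits-resp-≈ : Separated NearM _≈ᴹ_ → ∀ {x y : D → Carrierᴹ} {a b} →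
      ConvergesTo NearM Dir x a → ConvergesTo NearM Dir y b →
      (∀ s → x s ≈ᴹ y s) → a ≈ᴹ b
    limits-resp-≈ separated x→a y→b x≈y = separated _ _ λ v →
      let s , xs∼a , ys∼b = eventually⇒∃ (eventually-× (x→a v) (y→b v))
      in Near.∼-trans v (Near.∼-sym v xs∼a) (Near.∼-trans v (Near.∼-reflexive v (x≈y s)) ys∼b)

module ContLinProperties {R : CommutativeRing c ℓ} {k : LinTopRing R i p}
  (M : LinTopModule k m ℓm j q) (N : LinTopModule k n ℓn j' q') where
  private
    module M = LinTopModule M
    module N = LinTopModule N
    module MM = Module M.mod
    module NN = Module N.mod
  open CommutativeRing R using (0#)
  open LinTopModuleProperties M using (⋂-closed) renaming (module Near to NearM)
  open LinTopModuleProperties N using () renaming (module Near to NearN)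
  open ContLin

  module _ (F : ContLin M N) where

    f-0ᴹ : f F MM.0ᴹ NN.≈ᴹ NN.0ᴹ
    f-0ᴹ = begin
      f F MM.0ᴹ               ≈⟨ f-cong F (MM.*ₗ-zeroˡ MM.0ᴹ) ⟨
      f F (0# MM.*ₗ MM.0ᴹ)    ≈⟨ f-* F 0# MM.0ᴹ ⟩
      0# NN.*ₗ f F MM.0ᴹ      ≈⟨ NN.*ₗ-zeroˡ _ ⟩
      NN.0ᴹ                   ∎
      where open SetoidReasoning NN.≈ᴹ-setoid

    preimage-submodule : ∀ v → IsSubmodule M.mod (f F ⊢ N.U v)
    preimage-submodule v = record
      { resp  = λ x≈y → resp (f-cong F x≈y)
      ; zero∈ = resp (NN.≈ᴹ-sym f-0ᴹ) zero∈
      ; +∈    = λ fx∈U fy∈U → resp (NN.≈ᴹ-sym (f-+ F _ _)) (+∈ fx∈U fy∈U)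
      ; *∈    = λ r fx∈U → resp (NN.≈ᴹ-sym (f-* F r _)) (*∈ r fx∈U)
      }
      where open IsSubmodule (N.U-sub v)

    preimage-closed : ∀ v → Closed M (f F ⊢ N.U v)
    preimage-closed v x x∈cl with f-cont F x v
    ... | u , continuous-at-x with x∈cl u
    ... | y , fy∈U , x∼y =
      NearN.∈-resp-∼ v (NearN.∼-sym v (continuous-at-x y (NearM.∼-sym u x∼y))) fy∈U

  Equicontinuous : ∀ {I : Set ι} → (I → ContLin M N) → Set (ι ⊔ m ⊔ j ⊔ q ⊔ j' ⊔ q')
  Equicontinuous {I = I} F = ∀ v → OpenSub M (⋂ I λ s → f (F s) ⊢ N.U v)

  barrelled⇒equicontinuous : Uniform N → Barrelled M →
    ∀ {I : Set ι} (F : I → ContLin M N) → Equicontinuous F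
  barrelled⇒equicontinuous uniform barrelled F v =
    barrelled _ (⋂-submodule (λ s → preimage-submodule (F s) v))
                (⋂-closed (λ s → preimage-closed (F s) v))
                sponge
    where
    sponge : Sponge M (⋂ _ λ s → f (F s) ⊢ N.U v)
    sponge x = let t , J[t]N⊆U[v] = uniform v in
      t , λ r r∈J s → IsSubmodule.resp (N.U-sub v) (NN.≈ᴹ-sym (f-* (F s) r x))
                                        (J[t]N⊆U[v] r _ r∈J)

  additive-continuous-at-0⇒continuous : ∀ {g : MM.Carrierᴹ → NN.Carrierᴹ} →
    (∀ {x y} → x MM.≈ᴹ y → g x NN.≈ᴹ g y) →
    (∀ x y → g (x MM.+ᴹ y) NN.≈ᴹ g x NN.+ᴹ g y) →
    (∀ v → OpenSub M (g ⊢ N.U v)) →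
    ∀ x v → Σ M.Idx λ u → ∀ y → M.U u (y M.-ᴹ x) → N.U v (g y N.-ᴹ g x)
  additive-continuous-at-0⇒continuous {g} g-cong g-+ continuous-at-0 x v =
    let u , U[u]⊆g⁻¹U[v] = continuous-at-0 v in
    u , λ y y∼x → IsSubmodule.resp (N.U-sub v) (g-− x y) (U[u]⊆g⁻¹U[v] _ y∼x)
    where
    open SetoidReasoning NN.≈ᴹ-setoid
    open ModuleDifferences N.mod using (_−_)
    open ModuleDifferences M.mod using () renaming (_−_ to _−ᴹ_)
    open AbelianGroupProperties NN.+ᴹ-abelianGroup using (//-rightDividesʳ)
    open AbelianGroupProperties MM.+ᴹ-abelianGroup using (//-rightDividesˡ)

    g-− : ∀ x y → g (y −ᴹ x) NN.≈ᴹ g y − g x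
    g-− x y = begin
      g (y −ᴹ x)                   ≈⟨ //-rightDividesʳ (g x) (g (y −ᴹ x)) ⟨
      g (y −ᴹ x) NN.+ᴹ g x − g x   ≈⟨ NN.+ᴹ-congʳ (g-+ (y −ᴹ x) x) ⟨
      g (y −ᴹ x MM.+ᴹ x) − g x     ≈⟨ NN.+ᴹ-congʳ (g-cong (//-rightDividesˡ x y)) ⟩
      g y − g x                    ∎

module PointwiseLimit
  {R : CommutativeRing c ℓ} {k : LinTopRing R i p}
  {M : LinTopModule k m ℓm j q} {N : LinTopModule k n ℓn j' q'}
  (uniform : Uniform N) (barrelled : Barrelled M)
  (separated : Separated (LinTopModule.NearM N) (Module≈ N))
  (complete : Complete (LinTopModule.NearM N))
  (Dir : DirectedSet d e) (F : DirectedSet.D Dir → ContLin M N)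
  (pointwise-cauchy : ∀ x → IsCauchy (LinTopModule.NearM N) Dir (λ s → ContLin.f (F s) x))
  where
  private
    module N = LinTopModule N
    module MM = Module (LinTopModule.mod M)
    module NN = Module N.mod
  open LinTopModuleProperties N using (module Limits)
  open Limits Dir
  open ContLinProperties M N
  open ContLin

  lim : MM.Carrierᴹ → NN.Carrierᴹ
  lim x = proj₁ (complete Dir _ (pointwise-cauchy x))

  pointwise-converges : ∀ x → ConvergesTo N.NearM Dir (λ s → f (F s) x) (lim x)
  pointwise-converges x = proj₂ (complete Dir _ (pointwise-cauchy x))

  lim-cong : ∀ {x y} → x MM.≈ᴹ y → lim x NN.≈ᴹ lim y
  lim-cong {x} {y} x≈y = limits-resp-≈ separated
    (pointwise-converges x) (pointwise-converges y) (λ s → f-cong (F s) x≈y)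

  lim-+ : ∀ x y → lim (x MM.+ᴹ y) NN.≈ᴹ lim x NN.+ᴹ lim y
  lim-+ x y = limits-resp-≈ separated
    (pointwise-converges (x MM.+ᴹ y))
    (+ᴹ-converges (pointwise-converges x) (pointwise-converges y))
    (λ s → f-+ (F s) x y)

  lim-* : ∀ r x → lim (r MM.*ₗ x) NN.≈ᴹ r NN.*ₗ lim x
  lim-* r x = limits-resp-≈ separated
    (pointwise-converges (r MM.*ₗ x))
    (*ₗ-converges r (pointwise-converges x))
    (λ s → f-* (F s) r x)

  lim-continuous-at-0 : ∀ v → OpenSub M (lim ⊢ N.U v)
  lim-continuous-at-0 v =
    let u , U[u]⊆⋂ = barrelled⇒equicontinuous uniform barrelled F v in
    u , λ y y∈U → U-closed-under-limits (pointwise-converges y) (U[u]⊆⋂ y y∈U)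

  pointwiseLimit : ContLin M N
  pointwiseLimit = record
    { f      = lim
    ; f-cong = lim-cong
    ; f-+    = lim-+
    ; f-*    = lim-*
    ; f-cont = additive-continuous-at-0⇒continuous lim-cong lim-+ lim-continuous-at-0
    }

module _ {R : CommutativeRing c ℓ} {k : LinTopRing R i p}
  {M : LinTopModule k m ℓm j q} {N : LinTopModule k n ℓn j' q'}
  (separated : Separated (LinTopModule.NearM N) (Module≈ N)) where
  private
    module N = LinTopModule N
  open LinTopModuleProperties N using (module Near)
  open ContLin

  Near-s-separated : Separated (Near-s M N) (_≈L_ M N)
  Near-s-separated F G F~G x = separated _ _ λ v → head (F~G (v , x ∷ []))

  Near-b-separated : Separated (Near-b M N) (_≈L_ M N)
  Near-b-separated F G F~G x = separated _ _ λ v → F~G v x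

  module _ (uniform : Uniform N) (barrelled : Barrelled M)
           (complete : Complete N.NearM) where

    Near-s-complete : Complete (Near-s M N)
    Near-s-complete Dir F cauchy =
      pointwiseLimit , λ (v , xs) → eventually-All xs λ x → pointwise-converges x v
      where
      open Eventually Dir
      pointwise-cauchy : ∀ x → IsCauchy N.NearM Dir (λ s → f (F s) x)
      pointwise-cauchy x v =
        map₂ (λ from-δ s t δ≤s δ≤t → head (from-δ s t δ≤s δ≤t)) (cauchy (v , x ∷ []))
      open PointwiseLimit uniform barrelled separated complete Dir F pointwise-cauchy

    Near-b-complete : Complete (Near-b M N)
    Near-b-complete Dir F cauchy = pointwiseLimit , uniformly-converges
      where
      open Eventually Dir
      pointwise-cauchy : ∀ x → IsCauchy N.NearM Dir (λ s → f (F s) x)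
      pointwise-cauchy x v = map₂ (λ from-δ s t δ≤s δ≤t → from-δ s t δ≤s δ≤t x) (cauchy v)
      open PointwiseLimit uniform barrelled separated complete Dir F pointwise-cauchy

      uniformly-converges : ConvergesTo (Near-b M N) Dir F pointwiseLimit
      uniformly-converges v = let δ , cauchy-from-δ = cauchy v in
        δ , λ s δ≤s x →
          let t , δ≤t , Ft∼lim = eventually⇒∃ (eventually-× (δ , λ _ δ≤t → δ≤t)
                                                            (pointwise-converges x v))
          in Near.∼-trans v (cauchy-from-δ s t δ≤s δ≤t x) Ft∼lim

proposition7p3p7 : ∀ {c ℓ i p m ℓm j q n ℓn j' q'}
    (R : CommutativeRing c ℓ) (k : LinTopRing R i p)
    (M : LinTopModule k m ℓm j q) (N : LinTopModule k n ℓn j' q') →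
    Separated (LinTopRing.NearR k) (CommutativeRing._≈_ R) →
    Complete (LinTopRing.NearR k) →
    Uniform M → Uniform N →
    Barrelled M →
    Separated (LinTopModule.NearM N) (Module≈ N) →
    Complete (LinTopModule.NearM N) →
    ((Separated (Near-s M N) (_≈L_ M N) ×ˢω Complete (Near-s M N))
      ×ω (Separated (Near-b M N) (_≈L_ M N) ×ˢω Complete (Near-b M N)))
proposition7p3p7 R k M N _ _ _ uniform barrelled separated complete =
  (Near-s-separated separated ,ˢω Near-s-complete separated uniform barrelled complete)
  ,ω (Near-b-separated separated ,ˢω Near-b-complete separated uniform barrelled complete)
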